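{- The polynomial $\mathrm{L}_{K_n}(\mathbf{x};q)$ satisfy $\mathrm{L}_{K_0}(\mathbf{x};q) \coloneqq 1$ and $\mathrm{L}_{K_n}(\mathbf{x};q+1)$ is equal to \begin{align*} \sum_{i=0}^{n-1} \mathrm{L}_{K_i}(\mathbf{x};q+1) \mathrm{e}_{n-i}(\mathbf{x}) \left( \sum_{S\in \binom{[n-1]}{n-1-i}} \prod_{j=1}^{n-1-i} (q+1)^{s_j - j}[ (q+1)^j - 1 ] \right). \end{align*}
   Context: $K_m$ is the complete graph with area sequence $(0,1,\dotsc,m-1)$, i.e. vertex set $[m]$ with edges $u\to v$ for all $u<v$. For an area sequence $\mathbf{a}$, $O(\mathbf{a})$ is the set of orientations of the undirected unit interval graph $\Gamma_\mathbf{a}$; an edge is ascending in $\theta$ if oriented from smaller to larger vertex, $\mathrm{asc}(\theta)$ is the number of ascending edges; $\mathrm{hrv}_\theta(u)$ is the maximal vertex reachable from $u$ by a directed path of ascending edges; $\pi(\theta)$ is the partition of block sizes of the set partition of vertices by equal $\mathrm{hrv}_\theta$. $\mathrm{L}_\mathbf{a}$ is defined by $\mathrm{L}_{\mathbf{a}}(\mathbf{x};q+1)=\sum_{\theta\in O(\mathbf{a})}q^{\mathrm{asc}(\theta)}\mathrm{e}_{\pi(\theta)}(\mathbf{x})$, and $\mathrm{L}_{K_n}$ is this for $K_n$. $\binom{[n-1]}{k}$ is the set of $k$-subsets $S=\{s_1,\dotsc,s_k\}$ of $\{1,\dotsc,n-1\}$. -}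

module Defs where

open import Level using (Level)
open import Algebra.Bundles using (CommutativeRing)
open import Data.Nat as ℕ using (ℕ; zero; suc; _∸_; _⊔_)
open import Data.Bool using (Bool; true; false; _∧_; _∨_; if_then_else_)
open import Data.Unit using (⊤; tt)
open import Data.Product using (_×_; _,_)
open import Data.Fin as Fin using (Fin; zero; suc; toℕ)
open import Data.Fin.Properties using (_≟_)
open import Data.Vec as Vec using (Vec; []; _∷_; lookup)
open import Data.List as List using (List; []; _∷_; _++_; map; concatMap; allFin; foldr; filter; length)
open import Data.Nat.Properties using (_≟_)
open import Relation.Nullary.Decidable using (⌊_⌋)

-- Vertices are Fin n (order-preserving relabelling of [n]); edges are all
-- pairs u < v.  An orientation of K_(suc n) consists of the orientations of
-- the edges from the new smallest vertex `zero` to the vertices `suc j`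
-- (true = ascending, i.e. zero → suc j) together with an orientation of the
-- copy of K_n on the vertices `suc _`.

Orient : ℕ → Set
Orient zero    = ⊤
Orient (suc n) = Vec Bool n × Orient n

allVecs : (n : ℕ) → List (Vec Bool n)
allVecs zero    = [] ∷ []
allVecs (suc n) = concatMap (λ v → (false ∷ v) ∷ (true ∷ v) ∷ []) (allVecs n)

allOrient : (n : ℕ) → List (Orient n)
allOrient zero    = tt ∷ []
allOrient (suc n) = concatMap (λ bs → map (λ θ → (bs , θ)) (allOrient n)) (allVecs n)

isAsc : {n : ℕ} → Orient n → Fin n → Fin n → Bool
isAsc {suc n} (bs , θ) zero    (suc j) = lookup bs j
isAsc {suc n} (bs , θ) (suc i) (suc j) = isAsc θ i j
isAsc {suc n} (bs , θ) _       _       = false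

countTrue : {n : ℕ} → Vec Bool n → ℕ
countTrue []          = 0
countTrue (true ∷ v)  = suc (countTrue v)
countTrue (false ∷ v) = countTrue v

asc : {n : ℕ} → Orient n → ℕ
asc {zero}  tt       = 0
asc {suc n} (bs , θ) = countTrue bs ℕ.+ asc θ

anyFin : (n : ℕ) → (Fin n → Bool) → Bool
anyFin n p = foldr _∨_ false (map p (allFin n))

reachStep : {n : ℕ} → Orient n → (Fin n → Bool) → (Fin n → Bool)
reachStep {n} θ R w = R w ∨ anyFin n (λ v → R v ∧ isAsc θ v w)

iter : {A : Set} → ℕ → (A → A) → A → A
iter zero    f a = a
iter (suc k) f a = f (iter k f a)

-- reach θ u w = true iff w is reachable from u by a directed path of
-- ascending edges (paths have length < n, so n steps suffice)
reach : {n : ℕ} → Orient n → Fin n → Fin n → Bool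
reach {n} θ u = iter n (reachStep θ) (λ w → ⌊ u Data.Fin.Properties.≟ w ⌋)

hrv : {n : ℕ} → Orient n → Fin n → ℕ
hrv {n} θ u = foldr _⊔_ 0 (map toℕ (filter (λ w → Relation.Nullary.Decidable.T? (reach θ u w)) (allFin n)))
  where import Relation.Nullary.Decidable

-- size of the block of the set partition with hrv-value m
blockSize : {n : ℕ} → Orient n → Fin n → ℕ
blockSize {n} θ m = length (filter (λ u → hrv θ u Data.Nat.Properties.≟ toℕ m) (allFin n))

module _ {c ℓ : Level} (R : CommutativeRing c ℓ) where
  open CommutativeRing R

  pow : Carrier → ℕ → Carrier
  pow a zero    = 1#
  pow a (suc k) = a * pow a k

  esym : ℕ → List Carrier → Carrier
  esym zero    _        = 1#
  esym (suc k) []       = 0#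
  esym (suc k) (x ∷ xs) = esym (suc k) xs + x * esym k xs

  prodFin : (n : ℕ) → (Fin n → Carrier) → Carrier
  prodFin n f = foldr _*_ 1# (map f (allFin n))

  sumList : List Carrier → Carrier
  sumList = foldr _+_ 0#

  -- e_{π(θ)}(x) = ∏ over blocks of e_{block size}; empty "blocks" contribute e_0 = 1
  eπ : {n : ℕ} → List Carrier → Orient n → Carrier
  eπ {n} xs θ = prodFin n (λ m → esym (blockSize θ m) xs)

  -- LK xs q n  =  L_{K_n}(x; q+1)  =  Σ_{θ ∈ O(K_n)} q^{asc θ} e_{π(θ)}(x)
  LK : List Carrier → Carrier → ℕ → Carrier
  LK xs q n = sumList (map (λ θ → pow q (asc θ) * eπ xs θ) (allOrient n))

  sumTo : ℕ → (ℕ → Carrier) → Carrier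
  sumTo zero    f = 0#
  sumTo (suc n) f = sumTo n f + f n

  -- ∏_{j} (q+1)^{s_j - j} ((q+1)^j - 1) for an increasing list s_1 < s_2 < …,
  -- with j starting at the given index
  subsetWeight : Carrier → ℕ → List ℕ → Carrier
  subsetWeight q j []       = 1#
  subsetWeight q j (s ∷ ss) =
    (pow (1# + q) (s ∸ j) * (pow (1# + q) j - 1#)) * subsetWeight q (suc j) ss

-- k-subsets of {1,…,m}, each listed as an increasing list s_1 < … < s_k

subsets : ℕ → ℕ → List (List ℕ)
subsets zero    m       = [] ∷ []
subsets (suc k) zero    = []
subsets (suc k) (suc m) = subsets (suc k) m ++ map (λ s → s ++ (suc m ∷ [])) (subsets k m)

module Submission where

-- An orientation of K_(n+1) is an orientation θ′ of K_n on the vertices above a new smallest vertex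
-- v, together with the set S of ascending edges out of v.  The old vertices keep their hrv, and v
-- forms a new block if S = ∅ and otherwise joins the block of the highest hrv met by S.  So π(θ)
-- depends only on the block sizes of θ′ listed by hrv-level, and summing q^|S| over S acts on these
-- lists by a linear transfer step (Transfer.step); hence L_(K_n)(x; q+1) = run n e_λ [] (LK-run).
-- Following the block of the largest vertex through the n-1 later steps (run-singleton), it grows
-- by b with the total weight of the b-subsets of [n-1] (the steps at which it grows), while the
-- other n-1-b vertices build an arbitrary orientation of K_(n-1-b); reindexing by i = n-1-b gives
-- the lemma.

open import Defs
open import Level using (Level)
open import Algebra.Bundles using (CommutativeRing)
open import Data.Nat using (ℕ; _∸_; _≤_)
open import Data.List using (List; map)
open import Data.Product using (_×_)

import Data.Nat as ℕ
open import Data.Nat using (zero; suc; _<_; _⊔_; z≤n; s≤s)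
import Data.Nat.Properties as ℕₚ
open import Data.Nat.ListAction using (sum)
open import Data.Fin using (Fin; zero; suc; toℕ)
import Data.Fin.Properties as F
open import Data.Bool using (Bool; true; false; T; _∧_; if_then_else_)
open import Data.Bool.Properties using (T-∨; T-∧)
open import Data.Maybe using (Maybe; just; nothing; maybe)
open import Data.Vec using (Vec; []; _∷_; lookup)
open import Data.List using ([]; _∷_; _++_; _∷ʳ_; length; concatMap; foldr; filter; allFin; tabulate; applyUpTo)
open import Data.List.Properties using (length-++; length-applyUpTo; map-∘; map-cong; map-tabulate)
open import Data.List.Membership.Propositional using (_∈_; lose)
open import Data.List.Membership.Propositional.Properties
  using (∈-allFin; ∈-map⁺; ∈-map⁻; ∈-filter⁺; ∈-filter⁻; foldr-selective)
open import Data.List.Relation.Unary.All using (All; []; _∷_)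
import Data.List.Relation.Unary.All as All
import Data.List.Relation.Unary.All.Properties as All
open import Data.List.Relation.Unary.Any using (here; there)
import Data.List.Relation.Unary.Any as Any
open import Data.List.Relation.Unary.Any.Properties using (any⁺; any⁻)
open import Data.Product using (Σ; _,_; proj₂)
open import Data.Sum using (_⊎_; inj₁; inj₂)
open import Data.Empty using (⊥-elim)
open import Function using (_∘_; id)
open import Function.Bundles using (Equivalence)
open import Relation.Nullary using (¬_)
open import Relation.Nullary.Decidable using (⌊_⌋; T?; toWitness; fromWitness)
open import Relation.Unary using (Decidable)
open import Relation.Binary.PropositionalEquality as ≡ using (_≡_)
import Relation.Binary.Reasoning.Setoid

-- incAt M c increases the M-th entry of c by one (c is unchanged if M is out of range):
-- a vertex joins the block at level M.
incAt : ℕ → List ℕ → List ℕ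
incAt _       []      = []
incAt zero    (a ∷ c) = suc a ∷ c
incAt (suc M) (a ∷ c) = a ∷ incAt M c

incAt-sum : ∀ M c → M < length c → sum (incAt M c) ≡ suc (sum c)
incAt-sum zero    (a ∷ c) _        = ≡.refl
incAt-sum (suc M) (a ∷ c) (s≤s lt) = ≡.trans (≡.cong (a ℕ.+_) (incAt-sum M c lt)) (ℕₚ.+-suc a (sum c))

incAt-snoc< : ∀ M p k → M < length p → incAt M (p ∷ʳ k) ≡ incAt M p ∷ʳ k
incAt-snoc< zero    (a ∷ p) k _        = ≡.refl
incAt-snoc< (suc M) (a ∷ p) k (s≤s lt) = ≡.cong (a ∷_) (incAt-snoc< M p k lt)

incAt-snoc= : ∀ p k → incAt (length p) (p ∷ʳ k) ≡ p ∷ʳ suc k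
incAt-snoc= []      k = ≡.refl
incAt-snoc= (a ∷ p) k = ≡.cong (a ∷_) (incAt-snoc= p k)

subsets-tooLarge : ∀ m k → m < k → subsets k m ≡ []
subsets-tooLarge zero    (suc k) _        = ≡.refl
subsets-tooLarge (suc m) (suc k) (s≤s lt) =
  ≡.cong₂ (λ xs ys → xs ++ map (_∷ʳ suc m) ys)
    (subsets-tooLarge m (suc k) (ℕₚ.≤-trans lt (ℕₚ.n≤1+n k))) (subsets-tooLarge m k lt)

subsets-length : ∀ k m → All (λ S → length S ≡ k) (subsets k m)
subsets-length zero    m       = ≡.refl ∷ []
subsets-length (suc k) zero    = []
subsets-length (suc k) (suc m) =
  All.++⁺ (subsets-length (suc k) m) (All.map⁺ (All.map (λ {S} → snoc-length S) (subsets-length k m)))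
  where
  snoc-length : ∀ S → length S ≡ k → length (S ∷ʳ suc m) ≡ suc k
  snoc-length S eq = ≡.trans (length-++ S) (≡.trans (ℕₚ.+-comm (length S) 1) (≡.cong suc eq))

module Sums {c ℓ : Level} (R : CommutativeRing c ℓ) where
  open CommutativeRing R hiding (zero)
  open import Relation.Binary.Reasoning.Setoid setoid
  open import Algebra.Properties.CommutativeSemigroup +-commutativeSemigroup using (interchange)

  ΣL : {A : Set} → List A → (A → Carrier) → Carrier
  ΣL l f = sumList R (map f l)

  ΣL-cong : {A : Set} {f g : A → Carrier} (l : List A) → (∀ x → f x ≈ g x) → ΣL l f ≈ ΣL l g
  ΣL-cong []      fg = refl
  ΣL-cong (x ∷ l) fg = +-cong (fg x) (ΣL-cong l fg)

  ΣL-++ : {A : Set} (f : A → Carrier) (l l′ : List A) → ΣL (l ++ l′) f ≈ ΣL l f + ΣL l′ f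
  ΣL-++ f []      l′ = sym (+-identityˡ _)
  ΣL-++ f (x ∷ l) l′ = trans (+-congˡ (ΣL-++ f l l′)) (sym (+-assoc _ _ _))

  ΣL-+ : {A : Set} (f g : A → Carrier) (l : List A) → ΣL l (λ x → f x + g x) ≈ ΣL l f + ΣL l g
  ΣL-+ f g []      = sym (+-identityʳ _)
  ΣL-+ f g (x ∷ l) = trans (+-congˡ (ΣL-+ f g l)) (interchange _ _ _ _)

  ΣL-scale : {A : Set} (a : Carrier) (f : A → Carrier) (l : List A) → ΣL l (λ x → a * f x) ≈ a * ΣL l f
  ΣL-scale a f []      = sym (zeroʳ a)
  ΣL-scale a f (x ∷ l) = trans (+-congˡ (ΣL-scale a f l)) (sym (distribˡ _ _ _))

  ΣL-zero : {A : Set} (l : List A) → ΣL l (λ _ → 0#) ≈ 0#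
  ΣL-zero []      = refl
  ΣL-zero (_ ∷ l) = trans (+-identityˡ _) (ΣL-zero l)

  ΣL-concatMap : {A B : Set} (g : B → Carrier) (f : A → List B) (l : List A) →
    ΣL (concatMap f l) g ≈ ΣL l (λ x → ΣL (f x) g)
  ΣL-concatMap g f []      = refl
  ΣL-concatMap g f (x ∷ l) = trans (ΣL-++ g (f x) (concatMap f l)) (+-congˡ (ΣL-concatMap g f l))

  ΣL-map : {A B : Set} (g : B → Carrier) (f : A → B) (l : List A) → ΣL (map f l) g ≡ ΣL l (g ∘ f)
  ΣL-map g f l = ≡.cong (sumList R) (≡.sym (map-∘ l))

  ΣL-swap : {A B : Set} (h : A → B → Carrier) (l : List A) (l′ : List B) →
    ΣL l (λ x → ΣL l′ (h x)) ≈ ΣL l′ (λ y → ΣL l (λ x → h x y))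
  ΣL-swap h []      l′ = sym (ΣL-zero l′)
  ΣL-swap h (x ∷ l) l′ =
    trans (+-congˡ (ΣL-swap h l l′)) (sym (ΣL-+ (h x) (λ y → ΣL l (λ x → h x y)) l′))

  sumTo-cong : ∀ n {f g : ℕ → Carrier} → (∀ i → i < n → f i ≈ g i) → sumTo R n f ≈ sumTo R n g
  sumTo-cong zero    fg = refl
  sumTo-cong (suc n) fg = +-cong (sumTo-cong n (λ i i<n → fg i (ℕₚ.m<n⇒m<1+n i<n))) (fg n ℕₚ.≤-refl)

  sumTo-+ : ∀ n (f g : ℕ → Carrier) → sumTo R n (λ i → f i + g i) ≈ sumTo R n f + sumTo R n g
  sumTo-+ zero    f g = sym (+-identityʳ _)
  sumTo-+ (suc n) f g = trans (+-congʳ (sumTo-+ n f g)) (interchange _ _ _ _)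

  sumTo-first : ∀ n (f : ℕ → Carrier) → sumTo R (suc n) f ≈ f 0 + sumTo R n (f ∘ suc)
  sumTo-first zero    f = trans (+-identityˡ _) (sym (+-identityʳ _))
  sumTo-first (suc n) f = trans (+-congʳ (sumTo-first n f)) (+-assoc _ _ _)

  sumTo-reverse : ∀ m (f : ℕ → Carrier) → sumTo R (suc m) f ≈ sumTo R (suc m) (λ i → f (m ∸ i))
  sumTo-reverse zero    f = refl
  sumTo-reverse (suc m) f = begin
    sumTo R (suc m) f + f (suc m)                 ≈⟨ +-congʳ (sumTo-reverse m f) ⟩
    sumTo R (suc m) (λ i → f (m ∸ i)) + f (suc m) ≈⟨ +-comm _ _ ⟩
    f (suc m) + sumTo R (suc m) (λ i → f (m ∸ i)) ≈⟨ sumTo-first (suc m) (λ i → f (suc m ∸ i)) ⟨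
    sumTo R (suc (suc m)) (λ i → f (suc m ∸ i))   ∎

  sumTo-pascal : ∀ n (D D′ w Z : ℕ → Carrier) → D′ 0 ≈ D 0 → (∀ b → D′ (suc b) ≈ D (suc b) + D b * w b) →
    D (suc n) ≈ 0# →
    sumTo R (suc n) (λ b → D b * Z b + (D b * w b) * Z (suc b)) ≈ sumTo R (suc (suc n)) (λ b → D′ b * Z b)
  sumTo-pascal n D D′ w Z D′0 D′suc Dn≈0 = begin
    sumTo R (suc n) (λ b → D b * Z b + (D b * w b) * Z (suc b))
      ≈⟨ sumTo-+ (suc n) _ _ ⟩
    sumTo R (suc n) (λ b → D b * Z b) + Rest
      ≈⟨ +-congʳ (sumTo-first n _) ⟩
    (D 0 * Z 0 + sumTo R n (λ b → D (suc b) * Z (suc b))) + Rest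
      ≈⟨ +-congʳ (+-congˡ lastTerm) ⟨
    (D 0 * Z 0 + sumTo R (suc n) (λ b → D (suc b) * Z (suc b))) + Rest
      ≈⟨ +-assoc _ _ _ ⟩
    D 0 * Z 0 + (sumTo R (suc n) (λ b → D (suc b) * Z (suc b)) + Rest)
      ≈⟨ +-congˡ (sumTo-+ (suc n) _ _) ⟨
    D 0 * Z 0 + sumTo R (suc n) (λ b → D (suc b) * Z (suc b) + (D b * w b) * Z (suc b))
      ≈⟨ +-cong (*-congʳ D′0) (sumTo-cong (suc n) (λ b _ → trans (*-congʳ (D′suc b)) (distribʳ _ _ _))) ⟨
    D′ 0 * Z 0 + sumTo R (suc n) (λ b → D′ (suc b) * Z (suc b))
      ≈⟨ sumTo-first (suc n) _ ⟨
    sumTo R (suc (suc n)) (λ b → D′ b * Z b) ∎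
    where
    Rest : Carrier
    Rest = sumTo R (suc n) (λ b → (D b * w b) * Z (suc b))
    lastTerm : sumTo R (suc n) (λ b → D (suc b) * Z (suc b)) ≈ sumTo R n (λ b → D (suc b) * Z (suc b))
    lastTerm = trans (+-congˡ (trans (*-congʳ Dn≈0) (zeroˡ _))) (+-identityʳ _)

-- The transfer operator on level-count lists
--
-- A state is a list c = (c₀, c₁, …) of block sizes, listed by increasing hrv-level.  Adding a new
-- smallest vertex v, whose ascending edges go to a vertex set S of the old graph, either opens a
-- new lowest block (S = ∅), or lets v join the block of the highest level M met by S.  The
-- q^|S|-weighted count of the sets S with top level M is (1+q)^(c₀+…+c_(M-1)) ((1+q)^(c_M) - 1).

module Transfer {c ℓ : Level} (R : CommutativeRing c ℓ) (q : CommutativeRing.Carrier R) where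
  open CommutativeRing R hiding (zero)
  open import Relation.Binary.Reasoning.Setoid setoid
  open import Algebra.Solver.Ring.NaturalCoefficients.Default commutativeSemiring
    using (solve; _:+_; _:*_; _:=_; con)
  open import Algebra.Properties.Ring ring using (-‿distribˡ-*)
  open import Algebra.Properties.CommutativeSemigroup +-commutativeSemigroup using (interchange)
  open Sums R

  pow-+ : ∀ x a b → pow R x (a ℕ.+ b) ≈ pow R x a * pow R x b
  pow-+ x zero    b = sym (*-identityˡ _)
  pow-+ x (suc a) b = trans (*-congˡ (pow-+ x a b)) (sym (*-assoc _ _ _))

  -- Q^ a = (1+q)^a weighs all subsets of an a-set, nonempty a = (1+q)^a - 1 the nonempty ones.
  Q : Carrier
  Q = 1# + q

  Q^_ : ℕ → Carrier
  Q^ a = pow R Q a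

  nonempty : ℕ → Carrier
  nonempty a = Q^ a - 1#

  nonempty-zero : nonempty 0 ≈ 0#
  nonempty-zero = -‿inverseʳ 1#

  nonempty+1 : ∀ a → nonempty a + 1# ≈ Q^ a
  nonempty+1 a = begin
    (Q^ a - 1#) + 1#   ≈⟨ +-assoc _ _ _ ⟩
    Q^ a + (- 1# + 1#) ≈⟨ +-congˡ (-‿inverseˡ 1#) ⟩
    Q^ a + 0#          ≈⟨ +-identityʳ _ ⟩
    Q^ a               ∎

  -- a nonempty subset of an (a+1)-set: a nonempty one of the first a elements, with or without
  -- the last one, or the last element alone
  nonempty-suc : ∀ a → nonempty a * Q + q ≈ nonempty (suc a)
  nonempty-suc a = begin
    (Q^ a + - 1#) * (1# + q) + q
      ≈⟨ solve 3 (λ p m q → (p :+ m) :* (con 1 :+ q) :+ q := ((con 1 :+ q) :* p :+ m) :+ (m :* q :+ q))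
           refl (Q^ a) (- 1#) q ⟩
    (Q * Q^ a - 1#) + (- 1# * q + q) ≈⟨ +-congˡ cancel ⟩
    (Q * Q^ a - 1#) + 0#             ≈⟨ +-identityʳ _ ⟩
    nonempty (suc a)                 ∎
    where
    cancel : - 1# * q + q ≈ 0#
    cancel = trans (+-congʳ (trans (sym (-‿distribˡ-* 1# q)) (-‿cong (*-identityˡ q)))) (-‿inverseˡ q)

  -- selSum k c: the weighted sum over nonempty vertex sets S of k (top level of S).
  selSum : (ℕ → Carrier) → List ℕ → Carrier
  selSum k []      = 0#
  selSum k (a ∷ c) = nonempty a * k 0 + Q^ a * selSum (k ∘ suc) c

  selSum-cong : ∀ c {k k′ : ℕ → Carrier} → (∀ M → M < length c → k M ≈ k′ M) → selSum k c ≈ selSum k′ c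
  selSum-cong []      kk = refl
  selSum-cong (a ∷ c) kk =
    +-cong (*-congˡ (kk 0 (s≤s z≤n))) (*-congˡ (selSum-cong c (λ M lt → kk (suc M) (s≤s lt))))

  selSum-scale : ∀ c (α : Carrier) (k : ℕ → Carrier) → selSum (λ M → α * k M) c ≈ α * selSum k c
  selSum-scale []      α k = sym (zeroʳ α)
  selSum-scale (a ∷ c) α k = trans (+-congˡ (*-congˡ (selSum-scale c α (k ∘ suc))))
    (solve 5 (λ d α k p s → d :* (α :* k) :+ p :* (α :* s) := α :* (d :* k :+ p :* s)) refl _ _ _ _ _)

  selSum-+ : ∀ c (k k′ : ℕ → Carrier) → selSum (λ M → k M + k′ M) c ≈ selSum k c + selSum k′ c
  selSum-+ []      k k′ = sym (+-identityʳ _)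
  selSum-+ (a ∷ c) k k′ = trans (+-congˡ (*-congˡ (selSum-+ c (k ∘ suc) (k′ ∘ suc))))
    (solve 6 (λ d x y p s t → d :* (x :+ y) :+ p :* (s :+ t) := (d :* x :+ p :* s) :+ (d :* y :+ p :* t))
       refl _ _ _ _ _ _)

  -- a set whose top level is the last block a of p ∷ʳ a meets the blocks of p freely
  selSum-snoc : ∀ p a (k : ℕ → Carrier) →
    selSum k (p ∷ʳ a) ≈ selSum k p + (Q^ sum p * nonempty a) * k (length p)
  selSum-snoc []      a k =
    solve 3 (λ d k p → d :* k :+ p :* con 0 := con 0 :+ (con 1 :* d) :* k) refl (nonempty a) (k 0) (Q^ a)
  selSum-snoc (b ∷ p) a k = begin
    nonempty b * k 0 + Q^ b * selSum (k ∘ suc) (p ∷ʳ a)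
      ≈⟨ +-congˡ (*-congˡ (selSum-snoc p a (k ∘ suc))) ⟩
    nonempty b * k 0 + Q^ b * (selSum (k ∘ suc) p + (Q^ sum p * nonempty a) * k (suc (length p)))
      ≈⟨ solve 7 (λ d k₀ qb s qp da kl → d :* k₀ :+ qb :* (s :+ (qp :* da) :* kl)
                                     := (d :* k₀ :+ qb :* s) :+ ((qb :* qp) :* da) :* kl) refl _ _ _ _ _ _ _ ⟩
    selSum k (b ∷ p) + ((Q^ b * Q^ sum p) * nonempty a) * k (suc (length p))
      ≈⟨ +-congˡ (*-congʳ (*-congʳ (pow-+ Q b (sum p)))) ⟨
    selSum k (b ∷ p) + (Q^ (b ℕ.+ sum p) * nonempty a) * k (suc (length p)) ∎

  -- One more vertex at level v: a set S of the enlarged graph avoids it, contains it together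
  -- with a nonempty old set S′ (top level v ⊔ top S′), or is the new vertex alone.
  selSum-incAt : ∀ c v (k : ℕ → Carrier) → v < length c →
    selSum k c + q * selSum (λ M → k (v ⊔ M)) c + q * k v ≈ selSum k (incAt v c)
  selSum-incAt (a ∷ c) zero k _ = begin
    (nonempty a * k 0 + Q^ a * S) + q * (nonempty a * k 0 + Q^ a * S) + q * k 0
      ≈⟨ solve 5 (λ d p s k₀ q → (d :* k₀ :+ p :* s) :+ q :* (d :* k₀ :+ p :* s) :+ q :* k₀
                               := (d :* (con 1 :+ q) :+ q) :* k₀ :+ ((con 1 :+ q) :* p) :* s)
           refl (nonempty a) (Q^ a) S (k 0) q ⟩
    (nonempty a * Q + q) * k 0 + Q^ suc a * S ≈⟨ +-congʳ (*-congʳ (nonempty-suc a)) ⟩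
    nonempty (suc a) * k 0 + Q^ suc a * S     ∎
    where
    S : Carrier
    S = selSum (k ∘ suc) c
  selSum-incAt (a ∷ c) (suc v) k (s≤s lt) = begin
    (d * k 0 + Q^ a * S₁) + q * (d * kv + Q^ a * S₂) + q * kv
      ≈⟨ +-congʳ (+-cong (+-congˡ (*-congʳ d+1)) (*-congˡ (+-congˡ (*-congʳ d+1)))) ⟨
    (d * k 0 + (d + 1#) * S₁) + q * (d * kv + (d + 1#) * S₂) + q * kv
      ≈⟨ solve 6 (λ d k₀ s₁ s₂ kv q → (d :* k₀ :+ (d :+ con 1) :* s₁) :+ q :* (d :* kv :+ (d :+ con 1) :* s₂) :+ q :* kv
                                     := d :* k₀ :+ (d :+ con 1) :* (s₁ :+ q :* s₂ :+ q :* kv)) refl d (k 0) S₁ S₂ kv q ⟩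
    d * k 0 + (d + 1#) * (S₁ + q * S₂ + q * kv)
      ≈⟨ +-congˡ (*-cong d+1 (selSum-incAt c v (k ∘ suc) lt)) ⟩
    d * k 0 + Q^ a * selSum (k ∘ suc) (incAt v c) ∎
    where
    d S₁ S₂ kv : Carrier
    d  = nonempty a
    S₁ = selSum (k ∘ suc) c
    S₂ = selSum (λ M → k (suc (v ⊔ M))) c
    kv = k (suc v)
    d+1 : d + 1# ≈ Q^ a
    d+1 = nonempty+1 a

  -- step g: the new lowest vertex opens a new block, or joins the block of the top level it selects.
  step : (List ℕ → Carrier) → List ℕ → Carrier
  step g c = g (1 ∷ c) + selSum (λ M → g (incAt M c)) c

  run : ℕ → (List ℕ → Carrier) → List ℕ → Carrier
  run zero    g = g
  run (suc N) g = run N (step g)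

  run-suc : ∀ N g c → run (suc N) g c ≡ step (run N g) c
  run-suc zero    g c = ≡.refl
  run-suc (suc N) g c = run-suc N (step g) c

  step-cong : ∀ {g g′ : List ℕ → Carrier} → (∀ c → g c ≈ g′ c) → ∀ c → step g c ≈ step g′ c
  step-cong gg c = +-cong (gg _) (selSum-cong c (λ M _ → gg _))

  run-cong : ∀ N {g g′ : List ℕ → Carrier} → (∀ c → g c ≈ g′ c) → ∀ c → run N g c ≈ run N g′ c
  run-cong zero    gg c = gg c
  run-cong (suc N) gg c = run-cong N (step-cong gg) c

  step-scale : ∀ (α : Carrier) g c → step (λ c′ → α * g c′) c ≈ α * step g c
  step-scale α g c = trans (+-congˡ (selSum-scale c α (λ M → g (incAt M c)))) (sym (distribˡ _ _ _))

  run-scale : ∀ N (α : Carrier) g c → run N (λ c′ → α * g c′) c ≈ α * run N g c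
  run-scale zero    α g c = refl
  run-scale (suc N) α g c = trans (run-cong N (step-scale α g) c) (run-scale N α (step g) c)

  step-+ : ∀ (g g′ : List ℕ → Carrier) c → step (λ c′ → g c′ + g′ c′) c ≈ step g c + step g′ c
  step-+ g g′ c = trans (+-congˡ (selSum-+ c (λ M → g (incAt M c)) (λ M → g′ (incAt M c))))
    (interchange _ _ _ _)

  run-+ : ∀ N (g g′ : List ℕ → Carrier) c → run N (λ c′ → g c′ + g′ c′) c ≈ run N g c + run N g′ c
  run-+ zero    g g′ c = refl
  run-+ (suc N) g g′ c = trans (run-cong N (step-+ g g′) c) (run-+ N (step g) (step g′) c)

  -- every step adds exactly one vertex, so a factor (1+q)^(Σ c) comes out as (1+q)^(Σ c + N)
  step-shift : ∀ h c → step (λ c′ → Q^ sum c′ * h c′) c ≈ Q^ suc (sum c) * step h c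
  step-shift h c = begin
    Q^ suc (sum c) * h (1 ∷ c) + selSum (λ M → Q^ sum (incAt M c) * h (incAt M c)) c
      ≈⟨ +-congˡ (selSum-cong c (λ M lt → *-congʳ (reflexive (≡.cong Q^_ (incAt-sum M c lt))))) ⟩
    Q^ suc (sum c) * h (1 ∷ c) + selSum (λ M → Q^ suc (sum c) * h (incAt M c)) c
      ≈⟨ +-congˡ (selSum-scale c _ (λ M → h (incAt M c))) ⟩
    Q^ suc (sum c) * h (1 ∷ c) + Q^ suc (sum c) * selSum (λ M → h (incAt M c)) c
      ≈⟨ distribˡ _ _ _ ⟨
    Q^ suc (sum c) * step h c ∎

  run-shift : ∀ N h c → run N (λ c′ → Q^ sum c′ * h c′) c ≈ Q^ (sum c ℕ.+ N) * run N h c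
  run-shift zero    h c = *-congʳ (reflexive (≡.cong Q^_ (≡.sym (ℕₚ.+-identityʳ (sum c)))))
  run-shift (suc N) h c = begin
    run N (step (λ c′ → Q^ sum c′ * h c′)) c
      ≈⟨ run-cong N (λ c′ → trans (step-shift h c′) (trans (*-congʳ (*-comm Q _)) (*-assoc _ _ _))) c ⟩
    run N (λ c′ → Q^ sum c′ * (Q * step h c′)) c ≈⟨ run-shift N (λ c′ → Q * step h c′) c ⟩
    Q^ (sum c ℕ.+ N) * run N (λ c′ → Q * step h c′) c ≈⟨ *-congˡ (run-scale N Q (step h) c) ⟩
    Q^ (sum c ℕ.+ N) * (Q * run N (step h) c) ≈⟨ *-assoc _ _ _ ⟨
    (Q^ (sum c ℕ.+ N) * Q) * run N (step h) c ≈⟨ *-congʳ (*-comm _ _) ⟩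
    Q^ suc (sum c ℕ.+ N) * run N (step h) c
      ≈⟨ *-congʳ (reflexive (≡.cong Q^_ (≡.sym (ℕₚ.+-suc (sum c) N)))) ⟩
    Q^ (sum c ℕ.+ suc N) * run N (step h) c ∎

  subsetSum : ℕ → ℕ → Carrier
  subsetSum m k = ΣL (subsets k m) (subsetWeight R q 1)

  subsetWeight-snoc : ∀ j S x → subsetWeight R q j (S ∷ʳ x) ≈
    subsetWeight R q j S * (Q^ (x ∸ (j ℕ.+ length S)) * nonempty (j ℕ.+ length S))
  subsetWeight-snoc j [] x = begin
    (Q^ (x ∸ j) * nonempty j) * 1# ≈⟨ *-comm _ _ ⟩
    1# * (Q^ (x ∸ j) * nonempty j)
      ≈⟨ reflexive (≡.cong (λ t → 1# * (Q^ (x ∸ t) * nonempty t)) (≡.sym (ℕₚ.+-identityʳ j))) ⟩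
    1# * (Q^ (x ∸ (j ℕ.+ 0)) * nonempty (j ℕ.+ 0)) ∎
  subsetWeight-snoc j (s ∷ S) x = begin
    F * subsetWeight R q (suc j) (S ∷ʳ x) ≈⟨ *-congˡ (subsetWeight-snoc (suc j) S x) ⟩
    F * (subsetWeight R q (suc j) S * W (suc (j ℕ.+ length S))) ≈⟨ *-assoc _ _ _ ⟨
    (F * subsetWeight R q (suc j) S) * W (suc (j ℕ.+ length S))
      ≈⟨ reflexive (≡.cong (λ t → (F * subsetWeight R q (suc j) S) * W t) (≡.sym (ℕₚ.+-suc j (length S)))) ⟩
    (F * subsetWeight R q (suc j) S) * W (j ℕ.+ suc (length S)) ∎
    where
    F : Carrier
    F = Q^ (s ∸ j) * nonempty j
    W : ℕ → Carrier
    W t = Q^ (x ∸ t) * nonempty t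

  ΣL-subsetWeight-snoc : ∀ k x (l : List (List ℕ)) → All (λ S → length S ≡ k) l →
    ΣL (map (_∷ʳ x) l) (subsetWeight R q 1) ≈ ΣL l (subsetWeight R q 1) * (Q^ (x ∸ suc k) * nonempty (suc k))
  ΣL-subsetWeight-snoc k x []      []       = sym (zeroˡ _)
  ΣL-subsetWeight-snoc k x (S ∷ l) (eq ∷ l-len) = begin
    subsetWeight R q 1 (S ∷ʳ x) + ΣL (map (_∷ʳ x) l) (subsetWeight R q 1)
      ≈⟨ +-cong (subsetWeight-snoc 1 S x) (ΣL-subsetWeight-snoc k x l l-len) ⟩
    subsetWeight R q 1 S * W (suc (length S)) + ΣL l (subsetWeight R q 1) * W (suc k)
      ≈⟨ +-congʳ (reflexive (≡.cong (λ t → subsetWeight R q 1 S * W (suc t)) eq)) ⟩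
    subsetWeight R q 1 S * W (suc k) + ΣL l (subsetWeight R q 1) * W (suc k)
      ≈⟨ distribʳ _ _ _ ⟨
    (subsetWeight R q 1 S + ΣL l (subsetWeight R q 1)) * W (suc k) ∎
    where
    W : ℕ → Carrier
    W t = Q^ (x ∸ t) * nonempty t

  -- Pascal's rule: a (k+1)-subset of [m+1] avoids m+1, or is a k-subset of [m] followed by m+1.
  subsetSum-suc : ∀ m k → subsetSum (suc m) (suc k) ≈ subsetSum m (suc k) + subsetSum m k * (Q^ (m ∸ k) * nonempty (suc k))
  subsetSum-suc m k = begin
    ΣL (subsets (suc k) m ++ map (_∷ʳ suc m) (subsets k m)) (subsetWeight R q 1)
      ≈⟨ ΣL-++ (subsetWeight R q 1) (subsets (suc k) m) _ ⟩
    subsetSum m (suc k) + ΣL (map (_∷ʳ suc m) (subsets k m)) (subsetWeight R q 1)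
      ≈⟨ +-congˡ (ΣL-subsetWeight-snoc k (suc m) (subsets k m) (subsets-length k m)) ⟩
    subsetSum m (suc k) + subsetSum m k * (Q^ (m ∸ k) * nonempty (suc k)) ∎

  subsetSum-zero : ∀ m → subsetSum m 0 ≈ 1#
  subsetSum-zero m = +-identityʳ 1#

  subsetSum-tooLarge : ∀ m → subsetSum m (suc m) ≈ 0#
  subsetSum-tooLarge m = reflexive (≡.cong (λ l → ΣL l (subsetWeight R q 1)) (subsets-tooLarge m (suc m) ℕₚ.≤-refl))

  -- Watch the top block of a state p ∷ʳ k: a step either acts on the prefix p, or lets the new
  -- vertex join the top block, with weight (1+q)^(Σ p) ((1+q)^k - 1).
  step-snoc : ∀ (f : List ℕ → Carrier) (G : List ℕ → ℕ → Carrier) → (∀ p k → f (p ∷ʳ k) ≈ G p k) →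
    ∀ p k → step f (p ∷ʳ k) ≈ step (λ p′ → G p′ k) p + Q^ sum p * (nonempty k * G p (suc k))
  step-snoc f G fG p k = begin
    f (1 ∷ p ∷ʳ k) + selSum (λ M → f (incAt M (p ∷ʳ k))) (p ∷ʳ k)
      ≈⟨ +-congˡ (selSum-snoc p k _) ⟩
    f (1 ∷ p ∷ʳ k) + (selSum (λ M → f (incAt M (p ∷ʳ k))) p + (Q^ sum p * nonempty k) * f (incAt (length p) (p ∷ʳ k)))
      ≈⟨ +-cong (fG (1 ∷ p) k) (+-cong (selSum-cong p prefix) (*-congˡ top)) ⟩
    G (1 ∷ p) k + (selSum (λ M → G (incAt M p) k) p + (Q^ sum p * nonempty k) * G p (suc k))
      ≈⟨ trans (sym (+-assoc _ _ _)) (+-congˡ (*-assoc _ _ _)) ⟩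
    step (λ p′ → G p′ k) p + Q^ sum p * (nonempty k * G p (suc k)) ∎
    where
    prefix : ∀ M → M < length p → f (incAt M (p ∷ʳ k)) ≈ G (incAt M p) k
    prefix M lt = trans (reflexive (≡.cong f (incAt-snoc< M p k lt))) (fG _ _)
    top : f (incAt (length p) (p ∷ʳ k)) ≈ G p (suc k)
    top = trans (reflexive (≡.cong f (incAt-snoc= p k))) (fG p (suc k))

  -- Starting from one vertex, the block of that vertex grows by b during N further steps with total
  -- weight subsetSum N b (the steps at which it grows form a b-subset of [N]); the remaining steps
  -- build the lower blocks from scratch.
  run-singleton : ∀ N (f : List ℕ → Carrier) (G : List ℕ → ℕ → Carrier) → (∀ p k → f (p ∷ʳ k) ≈ G p k) →
    run N f (1 ∷ []) ≈ sumTo R (suc N) (λ b → subsetSum N b * run (N ∸ b) (λ p → G p (suc b)) [])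
  run-singleton zero f G fG = begin
    f (1 ∷ [])                 ≈⟨ fG [] 1 ⟩
    G [] 1                     ≈⟨ *-identityˡ _ ⟨
    1# * G [] 1                ≈⟨ *-congʳ (subsetSum-zero 0) ⟨
    subsetSum 0 0 * G [] 1      ≈⟨ +-identityˡ _ ⟨
    0# + subsetSum 0 0 * G [] 1 ∎
  run-singleton (suc N) f G fG = begin
    run N (step f) (1 ∷ [])
      ≈⟨ run-singleton N (step f) G′ (step-snoc f G fG) ⟩
    sumTo R (suc N) (λ b → subsetSum N b * run (N ∸ b) (λ p → G′ p (suc b)) [])
      ≈⟨ sumTo-cong (suc N) term ⟩
    sumTo R (suc N) (λ b → subsetSum N b * Z b + (subsetSum N b * w b) * Z (suc b))
      ≈⟨ sumTo-pascal N (subsetSum N) (subsetSum (suc N)) w Z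
           (trans (subsetSum-zero (suc N)) (sym (subsetSum-zero N))) (subsetSum-suc N) (subsetSum-tooLarge N) ⟩
    sumTo R (suc (suc N)) (λ b → subsetSum (suc N) b * Z b) ∎
    where
    G′ : List ℕ → ℕ → Carrier
    G′ p k = step (λ p′ → G p′ k) p + Q^ sum p * (nonempty k * G p (suc k))
    Z w : ℕ → Carrier
    Z b = run (suc N ∸ b) (λ p → G p (suc b)) []
    w b = Q^ (N ∸ b) * nonempty (suc b)
    term : ∀ b → b < suc N →
      subsetSum N b * run (N ∸ b) (λ p → G′ p (suc b)) [] ≈ subsetSum N b * Z b + (subsetSum N b * w b) * Z (suc b)
    term b (s≤s b≤N) = begin
      D * run (N ∸ b) (λ p → G′ p (suc b)) []
        ≈⟨ *-congˡ (run-+ (N ∸ b) _ _ []) ⟩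
      D * (run (suc (N ∸ b)) (λ p → G p (suc b)) [] + run (N ∸ b) (λ p → Q^ sum p * (E * G p (suc (suc b)))) [])
        ≈⟨ *-congˡ (+-cong (reflexive (≡.cong (λ t → run t (λ p → G p (suc b)) []) (≡.sym (ℕₚ.+-∸-assoc 1 b≤N))))
                           (trans (run-shift (N ∸ b) _ []) (*-congˡ (run-scale (N ∸ b) E _ [])))) ⟩
      D * (Z b + Q^ (N ∸ b) * (E * Z (suc b)))
        ≈⟨ solve 5 (λ d z p e z′ → d :* (z :+ p :* (e :* z′)) := d :* z :+ (d :* (p :* e)) :* z′) refl _ _ _ _ _ ⟩
      D * Z b + (D * w b) * Z (suc b) ∎
      where
      D E : Carrier
      D = subsetSum N b
      E = nonempty (suc b)

-- Reachability along ascending edges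

data Walk {n : ℕ} (θ : Orient n) (u : Fin n) : ℕ → Fin n → Set where
  []  : Walk θ u 0 u
  _▷_ : ∀ {m v w} → Walk θ u m v → T (isAsc θ v w) → Walk θ u (suc m) w

Reach : {n : ℕ} → Orient n → Fin n → Fin n → Set
Reach θ u w = Σ ℕ λ m → Walk θ u m w

isAsc⇒< : ∀ {n} (θ : Orient n) u w → T (isAsc θ u w) → toℕ u < toℕ w
isAsc⇒< {suc n} (bs , θ) zero    zero    ()
isAsc⇒< {suc n} (bs , θ) zero    (suc j) _ = s≤s z≤n
isAsc⇒< {suc n} (bs , θ) (suc i) zero    ()
isAsc⇒< {suc n} (bs , θ) (suc i) (suc j) a = s≤s (isAsc⇒< θ i j a)

-- a walk of length m climbs at least m vertices, so walks have length < n
walk-climbs : ∀ {n} {θ : Orient n} {u m w} → Walk θ u m w → toℕ u ℕ.+ m ≤ toℕ w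
walk-climbs {u = u} []          = ℕₚ.≤-reflexive (ℕₚ.+-identityʳ (toℕ u))
walk-climbs {θ = θ} {u} (_▷_ {m = m} {v} {w} p a) =
  ≡.subst (_≤ toℕ w) (≡.sym (ℕₚ.+-suc (toℕ u) m)) (ℕₚ.≤-trans (s≤s (walk-climbs p)) (isAsc⇒< θ v w a))

walk-cons : ∀ {n} {θ : Orient n} {u v m w} → T (isAsc θ u v) → Walk θ v m w → Walk θ u (suc m) w
walk-cons a []      = [] ▷ a
walk-cons a (p ▷ b) = walk-cons a p ▷ b

-- The boolean `reach` of the definitions decides Reach: after k rounds of reachStep exactly the
-- vertices at the end of walks of length ≤ k are marked.
module _ {n : ℕ} (θ : Orient n) (u : Fin n) where
  within : ℕ → Fin n → Bool
  within k = iter k (reachStep θ) (λ w → ⌊ u F.≟ w ⌋)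

  within-sound : ∀ k w → T (within k w) → Σ ℕ λ m → m ≤ k × Walk θ u m w
  within-sound zero w t with toWitness {a? = u F.≟ w} t
  ... | ≡.refl = 0 , z≤n , []
  within-sound (suc k) w t with Equivalence.to T-∨ t
  ... | inj₁ t′ = let m , m≤k , p = within-sound k w t′ in m , ℕₚ.m≤n⇒m≤1+n m≤k , p
  ... | inj₂ t′ =
    let v , tv  = Any.satisfied (any⁻ (λ v → within k v ∧ isAsc θ v w) (allFin n) t′)
        t₁ , a  = Equivalence.to T-∧ tv
        m , m≤k , p = within-sound k v t₁
    in suc m , s≤s m≤k , p ▷ a

  within-complete : ∀ k {m w} → Walk θ u m w → m ≤ k → T (within k w)
  within-complete zero    []      z≤n = fromWitness ≡.refl
  within-complete (suc k) []      _   = Equivalence.from T-∨ (inj₁ (within-complete k [] z≤n))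
  within-complete (suc k) (_▷_ {v = v} p a) (s≤s m≤k) =
    Equivalence.from T-∨ (inj₂ (any⁺ _ (lose (∈-allFin v) (Equivalence.from T-∧ (within-complete k p m≤k , a)))))

  reach-sound : ∀ w → T (reach θ u w) → Reach θ u w
  reach-sound w t = let m , _ , p = within-sound n w t in m , p

  reach-complete : ∀ w → Reach θ u w → T (reach θ u w)
  reach-complete w (m , p) = within-complete n p
    (ℕₚ.<⇒≤ (ℕₚ.≤-<-trans (ℕₚ.≤-trans (ℕₚ.m≤n+m m (toℕ u)) (walk-climbs p)) (F.toℕ<n w)))

≤-maximum : ∀ {x l} → x ∈ l → x ≤ foldr _⊔_ 0 l
≤-maximum (here ≡.refl) = ℕₚ.m≤m⊔n _ _
≤-maximum (there x∈l)   = ℕₚ.≤-trans (≤-maximum x∈l) (ℕₚ.m≤n⊔m _ _)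

module _ {n : ℕ} (θ : Orient n) (u : Fin n) where
  private
    reachable? : Decidable (λ w → T (reach θ u w))
    reachable? w = T? (reach θ u w)

  hrv-upper : ∀ {w} → Reach θ u w → toℕ w ≤ hrv θ u
  hrv-upper {w} r = ≤-maximum (∈-map⁺ toℕ (∈-filter⁺ reachable? (∈-allFin w) (reach-complete θ u w r)))

  hrv-attained : Σ (Fin n) λ w → Reach θ u w × hrv θ u ≡ toℕ w
  hrv-attained with foldr-selective ℕₚ.⊔-sel 0 (map toℕ (filter reachable? (allFin n)))
  ... | inj₂ h∈ =
    let w , w∈ , eq = ∈-map⁻ toℕ h∈
    in w , reach-sound θ u w (proj₂ (∈-filter⁻ reachable? {xs = allFin n} w∈)) , eq
  ... | inj₁ h≡0 = u , (0 , []) , ≡.trans h≡0 (≡.sym (ℕₚ.n≤0⇒n≡0 (≡.subst (toℕ u ≤_) h≡0 (hrv-upper (0 , [])))))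

hrv<n : ∀ {n} (θ : Orient n) u → hrv θ u < n
hrv<n θ u = let w , _ , eq = hrv-attained θ u in ≡.subst (_< _) (≡.sym eq) (F.toℕ<n w)

selMax : ∀ {n} → Vec Bool n → (Fin n → ℕ) → Maybe ℕ
selMax []           h = nothing
selMax (false ∷ bs) h = selMax bs (h ∘ suc)
selMax (true ∷ bs)  h = just (maybe (h zero ⊔_) (h zero) (selMax bs (h ∘ suc)))

selMax-nothing : ∀ {n} (bs : Vec Bool n) h → selMax bs h ≡ nothing → ∀ j → ¬ T (lookup bs j)
selMax-nothing (false ∷ bs) h eq (suc j) t = selMax-nothing bs (h ∘ suc) eq j t
selMax-nothing (true ∷ bs)  h () j t

selMax-upper : ∀ {n} (bs : Vec Bool n) h {M} → selMax bs h ≡ just M → ∀ j → T (lookup bs j) → h j ≤ M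
selMax-upper (false ∷ bs) h eq (suc j) t = selMax-upper bs (h ∘ suc) eq j t
selMax-upper (true ∷ bs)  h eq j t with selMax bs (h ∘ suc) in eq′
selMax-upper (true ∷ bs) h ≡.refl zero    t | nothing = ℕₚ.≤-refl
selMax-upper (true ∷ bs) h ≡.refl (suc j) t | nothing = ⊥-elim (selMax-nothing bs (h ∘ suc) eq′ j t)
selMax-upper (true ∷ bs) h ≡.refl zero    t | just M′ = ℕₚ.m≤m⊔n _ M′
selMax-upper (true ∷ bs) h ≡.refl (suc j) t | just M′ =
  ℕₚ.≤-trans (selMax-upper bs (h ∘ suc) eq′ j t) (ℕₚ.m≤n⊔m (h zero) M′)

selMax-attained : ∀ {n} (bs : Vec Bool n) h {M} → selMax bs h ≡ just M → Σ (Fin n) λ j → T (lookup bs j) × h j ≡ M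
selMax-attained (false ∷ bs) h eq = let j , t , hj = selMax-attained bs (h ∘ suc) eq in suc j , t , hj
selMax-attained (true ∷ bs)  h eq with selMax bs (h ∘ suc) in eq′
selMax-attained (true ∷ bs) h ≡.refl | nothing = zero , _ , ≡.refl
selMax-attained (true ∷ bs) h ≡.refl | just M′ with ℕₚ.⊔-sel (h zero) M′
... | inj₁ sel = zero , _ , ≡.sym sel
... | inj₂ sel = let j , t , hj = selMax-attained bs (h ∘ suc) eq′ in suc j , t , ≡.trans hj (≡.sym sel)

-- hrv after adding a new smallest vertex
--
-- The old vertices
-- keep their hrv (relabelled by suc); the new vertex reaches only itself if it selects no edge,
-- and otherwise the highest hrv among the selected vertices.

newLevel : Maybe ℕ → ℕ
newLevel nothing  = 0
newLevel (just M) = suc M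

module Extension {n : ℕ} (bs : Vec Bool n) (θ′ : Orient n) where
  private
    θ : Orient (suc n)
    θ = bs , θ′

  lower : ∀ {u m v} → Walk θ (suc u) m v → Σ (Fin n) λ v′ → v ≡ suc v′ × Walk θ′ u m v′
  lower []                    = _ , ≡.refl , []
  lower (_▷_ {w = w} p a) with lower p
  lower (_▷_ {w = zero}  p ()) | v′ , ≡.refl , p′
  lower (_▷_ {w = suc w} p a)  | v′ , ≡.refl , p′ = w , ≡.refl , p′ ▷ a

  lift : ∀ {u m w} → Walk θ′ u m w → Walk θ (suc u) m (suc w)
  lift []      = []
  lift (p ▷ a) = lift p ▷ a

  fromNew : ∀ {m w} → Walk θ zero m w →
    w ≡ zero ⊎ Σ (Fin n) λ w′ → w ≡ suc w′ × Σ (Fin n) λ j → T (lookup bs j) × Reach θ′ j w′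
  fromNew [] = inj₁ ≡.refl
  fromNew (_▷_ {w = w} p a) with fromNew p
  fromNew (_▷_ {w = zero}  p ()) | inj₁ ≡.refl
  fromNew (_▷_ {w = suc j} p a)  | inj₁ ≡.refl = inj₂ (j , ≡.refl , j , a , 0 , [])
  fromNew (_▷_ {w = zero}  p ()) | inj₂ (w′ , ≡.refl , _)
  fromNew (_▷_ {w = suc w} p a)  | inj₂ (w′ , ≡.refl , j , t , m , p′) = inj₂ (w , ≡.refl , j , t , suc m , p′ ▷ a)

  toNew : ∀ {j w} → T (lookup bs j) → Reach θ′ j w → Reach θ zero (suc w)
  toNew t (m , p) = suc m , walk-cons t (lift p)

  hrv-old : ∀ u → hrv θ (suc u) ≡ suc (hrv θ′ u)
  hrv-old u = ℕₚ.≤-antisym upper lower-bound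
    where
    upper : hrv θ (suc u) ≤ suc (hrv θ′ u)
    upper with hrv-attained θ (suc u)
    ... | w , (m , p) , eq with lower p
    ...   | w′ , ≡.refl , p′ = ≡.subst (_≤ _) (≡.sym eq) (s≤s (hrv-upper θ′ u (m , p′)))
    lower-bound : suc (hrv θ′ u) ≤ hrv θ (suc u)
    lower-bound with hrv-attained θ′ u
    ... | w , (m , p) , eq = ≡.subst (λ t → suc t ≤ _) (≡.sym eq) (hrv-upper θ (suc u) (m , lift p))

  hrv-new : hrv θ zero ≡ newLevel (selMax bs (hrv θ′))
  hrv-new with selMax bs (hrv θ′) in eq
  ... | nothing with hrv-attained θ zero
  ...   | w , (m , p) , h≡ with fromNew p
  ...     | inj₁ ≡.refl = h≡
  ...     | inj₂ (w′ , ≡.refl , j , t , _) = ⊥-elim (selMax-nothing bs (hrv θ′) eq j t)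
  hrv-new | just M = ℕₚ.≤-antisym upper lower-bound
    where
    upper : hrv θ zero ≤ suc M
    upper with hrv-attained θ zero
    ... | w , (m , p) , h≡ with fromNew p
    ...   | inj₁ ≡.refl = ≡.subst (_≤ suc M) (≡.sym h≡) z≤n
    ...   | inj₂ (w′ , ≡.refl , j , t , r) =
      ≡.subst (_≤ suc M) (≡.sym h≡) (s≤s (ℕₚ.≤-trans (hrv-upper θ′ j r) (selMax-upper bs (hrv θ′) eq j t)))
    lower-bound : suc M ≤ hrv θ zero
    lower-bound with selMax-attained bs (hrv θ′) eq
    ... | j , t , hj with hrv-attained θ′ j
    ...   | w , r , h≡ = ≡.subst (λ x → suc x ≤ _) (≡.trans (≡.sym h≡) hj) (hrv-upper θ zero (toNew t r))

indicator : ℕ → ℕ → ℕ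
indicator a m = if a ℕ.≡ᵇ m then 1 else 0

count : (n : ℕ) → (Fin n → ℕ) → ℕ → ℕ
count zero    h m = 0
count (suc n) h m = indicator (h zero) m ℕ.+ count n (h ∘ suc) m

count-cong : ∀ n {h h′ : Fin n → ℕ} m → (∀ j → h j ≡ h′ j) → count n h m ≡ count n h′ m
count-cong zero    m hh = ≡.refl
count-cong (suc n) m hh = ≡.cong₂ (λ a b → indicator a m ℕ.+ b) (hh zero) (count-cong n m (hh ∘ suc))

count-suc-zero : ∀ n (h : Fin n → ℕ) → count n (suc ∘ h) 0 ≡ 0
count-suc-zero zero    h = ≡.refl
count-suc-zero (suc n) h = count-suc-zero n (h ∘ suc)

count-suc-suc : ∀ n (h : Fin n → ℕ) m → count n (suc ∘ h) (suc m) ≡ count n h m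
count-suc-suc zero    h m = ≡.refl
count-suc-suc (suc n) h m = ≡.cong (indicator (h zero) m ℕ.+_) (count-suc-suc n (h ∘ suc) m)

count-filter : ∀ {A : Set} (g : A → ℕ) m n (f : Fin n → A) →
  length (filter (λ a → g a ℕₚ.≟ m) (tabulate f)) ≡ count n (g ∘ f) m
count-filter g m zero    f = ≡.refl
count-filter g m (suc n) f with g (f zero) ℕ.≡ᵇ m
... | true  = ≡.cong suc (count-filter g m n (f ∘ suc))
... | false = count-filter g m n (f ∘ suc)

blockSize-count : ∀ {n} (θ : Orient n) m → blockSize θ m ≡ count n (hrv θ) (toℕ m)
blockSize-count {n} θ m = count-filter (hrv θ) (toℕ m) n id

tabulate-applyUpTo : ∀ {A : Set} L (f : ℕ → A) → tabulate {n = L} (f ∘ toℕ) ≡ applyUpTo f L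
tabulate-applyUpTo zero    f = ≡.refl
tabulate-applyUpTo (suc L) f = ≡.cong (f 0 ∷_) (tabulate-applyUpTo L (f ∘ suc))

applyUpTo-cong : ∀ {A : Set} L {f g : ℕ → A} → (∀ m → f m ≡ g m) → applyUpTo f L ≡ applyUpTo g L
applyUpTo-cong zero    fg = ≡.refl
applyUpTo-cong (suc L) fg = ≡.cong₂ _∷_ (fg 0) (applyUpTo-cong L (fg ∘ suc))

incAt-applyUpTo : ∀ L M f → incAt M (applyUpTo f L) ≡ applyUpTo (λ m → indicator M m ℕ.+ f m) L
incAt-applyUpTo zero    M       f = ≡.refl
incAt-applyUpTo (suc L) zero    f = ≡.refl
incAt-applyUpTo (suc L) (suc M) f = ≡.cong (f 0 ∷_) (incAt-applyUpTo L M (f ∘ suc))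

-- levels θ: entry m is the size of the block of vertices with hrv m (possibly 0)
levels : ∀ {n} → Orient n → List ℕ
levels {n} θ = applyUpTo (count n (hrv θ)) n

blockSizes-levels : ∀ {n} (θ : Orient n) → map (blockSize θ) (allFin n) ≡ levels θ
blockSizes-levels {n} θ = begin
  map (blockSize θ) (allFin n)           ≡⟨ map-cong (blockSize-count θ) (allFin n) ⟩
  map (count n (hrv θ) ∘ toℕ) (allFin n) ≡⟨ map-tabulate id (count n (hrv θ) ∘ toℕ) ⟩
  tabulate (count n (hrv θ) ∘ toℕ)       ≡⟨ tabulate-applyUpTo n (count n (hrv θ)) ⟩
  levels θ                               ∎
  where open ≡.≡-Reasoning

-- the effect of a new smallest vertex that selects the top level M (or nothing)
newLevels : Maybe ℕ → List ℕ → List ℕ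
newLevels nothing  c = 1 ∷ c
newLevels (just M) c = 0 ∷ incAt M c

levels-extend : ∀ {n} (bs : Vec Bool n) (θ′ : Orient n) →
  levels {suc n} (bs , θ′) ≡ newLevels (selMax bs (hrv θ′)) (levels θ′)
levels-extend {n} bs θ′ = ≡.trans (applyUpTo-cong (suc n) counts) (shifted (selMax bs h))
  where
  open Extension bs θ′
  h : Fin n → ℕ
  h = hrv θ′
  counts : ∀ m → count (suc n) (hrv {suc n} (bs , θ′)) m ≡ indicator (newLevel (selMax bs h)) m ℕ.+ count n (suc ∘ h) m
  counts m = ≡.cong₂ (λ a b → indicator a m ℕ.+ b) hrv-new (count-cong n m hrv-old)
  shifted : ∀ s → applyUpTo (λ m → indicator (newLevel s) m ℕ.+ count n (suc ∘ h) m) (suc n) ≡ newLevels s (levels θ′)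
  shifted nothing  = ≡.cong₂ _∷_ (≡.cong suc (count-suc-zero n h)) (applyUpTo-cong n (count-suc-suc n h))
  shifted (just M) = ≡.cong₂ _∷_ (count-suc-zero n h)
    (≡.trans (applyUpTo-cong n (λ m → ≡.cong (indicator M m ℕ.+_) (count-suc-suc n h m)))
             (≡.sym (incAt-applyUpTo n M (count n h))))

-- Summing over all orientations

module Orientations {c ℓ : Level} (R : CommutativeRing c ℓ) (q : CommutativeRing.Carrier R) where
  open CommutativeRing R hiding (zero)
  open import Relation.Binary.Reasoning.Setoid setoid
  open import Algebra.Solver.Ring.NaturalCoefficients.Default commutativeSemiring
    using (solve; _:+_; _:*_; _:=_)
  open Sums R
  open Transfer R q

  ΣVec : (n : ℕ) → (Vec Bool n → Carrier) → Carrier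
  ΣVec n F = ΣL (allVecs n) (λ bs → pow R q (countTrue bs) * F bs)

  ΣVec-suc : ∀ n F → ΣVec (suc n) F ≈ ΣVec n (F ∘ (false ∷_)) + q * ΣVec n (F ∘ (true ∷_))
  ΣVec-suc n F = begin
    ΣL (concatMap (λ v → (false ∷ v) ∷ (true ∷ v) ∷ []) (allVecs n)) G
      ≈⟨ ΣL-concatMap G _ (allVecs n) ⟩
    ΣL (allVecs n) (λ v → G (false ∷ v) + (G (true ∷ v) + 0#))
      ≈⟨ ΣL-cong (allVecs n) (λ v → +-congˡ (trans (+-identityʳ _) (*-assoc _ _ _))) ⟩
    ΣL (allVecs n) (λ v → G (false ∷ v) + q * (pow R q (countTrue v) * F (true ∷ v)))
      ≈⟨ ΣL-+ _ _ (allVecs n) ⟩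
    ΣVec n (F ∘ (false ∷_)) + ΣL (allVecs n) (λ v → q * (pow R q (countTrue v) * F (true ∷ v)))
      ≈⟨ +-congˡ (ΣL-scale q _ (allVecs n)) ⟩
    ΣVec n (F ∘ (false ∷_)) + q * ΣVec n (F ∘ (true ∷_)) ∎
    where
    G : Vec Bool (suc n) → Carrier
    G bs = pow R q (countTrue bs) * F bs

  selSum-zeros : ∀ L (k : ℕ → Carrier) → selSum k (applyUpTo (λ _ → 0) L) ≈ 0#
  selSum-zeros zero    k = refl
  selSum-zeros (suc L) k = begin
    nonempty 0 * k 0 + 1# * selSum (k ∘ suc) (applyUpTo (λ _ → 0) L)
      ≈⟨ +-cong (trans (*-congʳ nonempty-zero) (zeroˡ _)) (trans (*-identityˡ _) (selSum-zeros L (k ∘ suc))) ⟩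
    0# + 0# ≈⟨ +-identityʳ _ ⟩
    0#      ∎

  -- Grouping the edge choices of a new vertex by the highest value of h they select: with
  -- count n h the numbers of vertices per value, this is the selection sum.
  ΣVec-selMax : ∀ n L (h : Fin n → ℕ) → (∀ j → h j < L) → (K : Maybe ℕ → Carrier) →
    ΣVec n (λ bs → K (selMax bs h)) ≈ K nothing + selSum (K ∘ just) (applyUpTo (count n h) L)
  ΣVec-selMax zero L h h<L K = begin
    1# * K nothing + 0#                              ≈⟨ trans (+-identityʳ _) (*-identityˡ _) ⟩
    K nothing                                        ≈⟨ +-identityʳ _ ⟨
    K nothing + 0#                                   ≈⟨ +-congˡ (selSum-zeros L _) ⟨
    K nothing + selSum (K ∘ just) (applyUpTo (λ _ → 0) L) ∎
  ΣVec-selMax (suc n) L h h<L K = begin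
    ΣVec (suc n) (λ bs → K (selMax bs h))
      ≈⟨ ΣVec-suc n _ ⟩
    ΣVec n (λ bs → K (selMax bs (h ∘ suc))) + q * ΣVec n (λ bs → K′ (selMax bs (h ∘ suc)))
      ≈⟨ +-cong (ΣVec-selMax n L (h ∘ suc) (h<L ∘ suc) K) (*-congˡ (ΣVec-selMax n L (h ∘ suc) (h<L ∘ suc) K′)) ⟩
    (K nothing + selSum k cs) + q * (k v + selSum (λ M → k (v ⊔ M)) cs)
      ≈⟨ solve 5 (λ a b cs d e → (a :+ b) :+ cs :* (d :+ e) := a :+ ((b :+ cs :* e) :+ cs :* d)) refl _ _ _ _ _ ⟩
    K nothing + ((selSum k cs + q * selSum (λ M → k (v ⊔ M)) cs) + q * k v)
      ≈⟨ +-congˡ (selSum-incAt cs v k (≡.subst (v <_) (≡.sym (length-applyUpTo _ L)) (h<L zero))) ⟩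
    K nothing + selSum k (incAt v cs)
      ≡⟨ ≡.cong (λ cs′ → K nothing + selSum k cs′) (incAt-applyUpTo L v (count n (h ∘ suc))) ⟩
    K nothing + selSum k (applyUpTo (count (suc n) h) L) ∎
    where
    v : ℕ
    v = h zero
    cs : List ℕ
    cs = applyUpTo (count n (h ∘ suc)) L
    k : ℕ → Carrier
    k = K ∘ just
    K′ : Maybe ℕ → Carrier
    K′ s = K (just (maybe (v ⊔_) v s))

  orientSum : (n : ℕ) → (List ℕ → Carrier) → Carrier
  orientSum n F = ΣL (allOrient n) (λ θ → pow R q (asc θ) * F (levels θ))

  orientSum-cong : ∀ n {F F′ : List ℕ → Carrier} → (∀ c → F c ≈ F′ c) → orientSum n F ≈ orientSum n F′
  orientSum-cong n FF = ΣL-cong (allOrient n) (λ θ → *-congˡ (FF _))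

  -- the transfer step before deleting the empty level 0 created by newLevels
  step₀ : (List ℕ → Carrier) → List ℕ → Carrier
  step₀ g c = g (1 ∷ c) + selSum (λ M → g (0 ∷ incAt M c)) c

  -- O(K_(n+1)) = {0,1}^n × O(K_n): sum over the edges of the new vertex first
  orientSum-suc : ∀ n F → orientSum (suc n) F ≈ orientSum n (step₀ F)
  orientSum-suc n F = begin
    ΣL (concatMap (λ bs → map (bs ,_) (allOrient n)) (allVecs n)) g
      ≈⟨ ΣL-concatMap g _ (allVecs n) ⟩
    ΣL (allVecs n) (λ bs → ΣL (map (bs ,_) (allOrient n)) g)
      ≈⟨ ΣL-cong (allVecs n) (λ bs → trans (reflexive (ΣL-map g _ (allOrient n))) (ΣL-cong (allOrient n) (split bs))) ⟩
    ΣL (allVecs n) (λ bs → ΣL (allOrient n) (H bs))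
      ≈⟨ ΣL-swap H (allVecs n) (allOrient n) ⟩
    ΣL (allOrient n) (λ θ → ΣL (allVecs n) (λ bs → H bs θ))
      ≈⟨ ΣL-cong (allOrient n) (λ θ → trans (ΣL-scale (pow R q (asc θ)) _ (allVecs n))
            (*-congˡ (ΣVec-selMax n n (hrv θ) (hrv<n θ) (λ s → F (newLevels s (levels θ)))))) ⟩
    orientSum n (step₀ F) ∎
    where
    g : Orient (suc n) → Carrier
    g θ = pow R q (asc θ) * F (levels θ)
    H : Vec Bool n → Orient n → Carrier
    H bs θ = pow R q (asc θ) * (pow R q (countTrue bs) * F (newLevels (selMax bs (hrv θ)) (levels θ)))
    split : ∀ bs θ → g (bs , θ) ≈ H bs θ
    split bs θ = begin
      pow R q (countTrue bs ℕ.+ asc θ) * F (levels {suc n} (bs , θ))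
        ≈⟨ *-cong (pow-+ q (countTrue bs) (asc θ)) (reflexive (≡.cong F (levels-extend bs θ))) ⟩
      (pow R q (countTrue bs) * pow R q (asc θ)) * F (newLevels (selMax bs (hrv θ)) (levels θ))
        ≈⟨ solve 3 (λ a b c → (a :* b) :* c := b :* (a :* c)) refl _ _ _ ⟩
      H bs θ ∎

  -- Empty levels carry no information: once they are deleted, step₀ becomes the transfer step.
  dropZeros : List ℕ → List ℕ
  dropZeros []          = []
  dropZeros (zero ∷ c)  = dropZeros c
  dropZeros (suc a ∷ c) = suc a ∷ dropZeros c

  selSum-dropZeros : ∀ c (g : List ℕ → Carrier) →
    selSum (λ M → g (dropZeros (incAt M c))) c ≈ selSum (λ M → g (incAt M (dropZeros c))) (dropZeros c)
  selSum-dropZeros []          g = refl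
  selSum-dropZeros (zero ∷ c)  g = begin
    nonempty 0 * g (dropZeros (1 ∷ c)) + 1# * selSum (λ M → g (dropZeros (incAt M c))) c
      ≈⟨ +-cong (trans (*-congʳ nonempty-zero) (zeroˡ _)) (*-identityˡ _) ⟩
    0# + selSum (λ M → g (dropZeros (incAt M c))) c ≈⟨ +-identityˡ _ ⟩
    selSum (λ M → g (dropZeros (incAt M c))) c      ≈⟨ selSum-dropZeros c g ⟩
    selSum (λ M → g (incAt M (dropZeros c))) (dropZeros c) ∎
  selSum-dropZeros (suc a ∷ c) g = +-congˡ (*-congˡ (selSum-dropZeros c (g ∘ (suc a ∷_))))

  orientSum-run : ∀ n (F : List ℕ → Carrier) → orientSum n (F ∘ dropZeros) ≈ run n F []
  orientSum-run zero    F = trans (+-identityʳ _) (*-identityˡ _)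
  orientSum-run (suc n) F = begin
    orientSum (suc n) (F ∘ dropZeros)  ≈⟨ orientSum-suc n (F ∘ dropZeros) ⟩
    orientSum n (step₀ (F ∘ dropZeros))
      ≈⟨ orientSum-cong n (λ c → +-congˡ {x = F (1 ∷ dropZeros c)} (selSum-dropZeros c F)) ⟩
    orientSum n (step F ∘ dropZeros)   ≈⟨ orientSum-run n (step F) ⟩
    run n (step F) []                  ∎

-- The recursion for L_(K_n)

module Recursion {c ℓ : Level} (R : CommutativeRing c ℓ) (xs : List (CommutativeRing.Carrier R))
                 (q : CommutativeRing.Carrier R) where
  open CommutativeRing R hiding (zero)
  open import Relation.Binary.Reasoning.Setoid setoid
  open Sums R
  open Transfer R q
  open Orientations R q

  E : ℕ → Carrier
  E k = esym R k xs

  eProd : List ℕ → Carrier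
  eProd l = foldr _*_ 1# (map E l)

  eProd-dropZeros : ∀ c → eProd (dropZeros c) ≈ eProd c
  eProd-dropZeros []          = refl
  eProd-dropZeros (zero ∷ c)  = trans (eProd-dropZeros c) (sym (*-identityˡ _))
  eProd-dropZeros (suc a ∷ c) = *-congˡ (eProd-dropZeros c)

  eProd-snoc : ∀ p k → eProd (p ∷ʳ k) ≈ eProd p * E k
  eProd-snoc []      k = trans (*-identityʳ _) (sym (*-identityˡ _))
  eProd-snoc (a ∷ p) k = trans (*-congˡ (eProd-snoc p k)) (sym (*-assoc _ _ _))

  eπ-levels : ∀ {n} (θ : Orient n) → eπ R xs θ ≈ eProd (levels θ)
  eπ-levels {n} θ =
    reflexive (≡.cong (foldr _*_ 1#) (≡.trans (map-∘ (allFin n)) (≡.cong (map E) (blockSizes-levels θ))))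

  LK-run : ∀ n → LK R xs q n ≈ run n eProd []
  LK-run n = trans (ΣL-cong (allOrient n) (λ θ → *-congˡ (trans (eπ-levels θ) (sym (eProd-dropZeros (levels θ))))))
                   (orientSum-run n eProd)

  LK-zero : LK R xs q 0 ≈ 1#
  LK-zero = trans (+-identityʳ _) (*-identityˡ _)

  -- Follow the block of the largest vertex n: it grows by b with weight subsetSum (n-1) b, and the
  -- other n-1-b vertices form an arbitrary orientation of a complete graph below it.
  LK-suc : ∀ m → LK R xs q (suc m) ≈ sumTo R (suc m) (λ b → subsetSum m b * (LK R xs q (m ∸ b) * E (suc b)))
  LK-suc m = begin
    LK R xs q (suc m)         ≈⟨ LK-run (suc m) ⟩
    run (suc m) eProd []      ≡⟨ run-suc m eProd [] ⟩
    run m eProd (1 ∷ []) + 0# ≈⟨ +-identityʳ _ ⟩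
    run m eProd (1 ∷ [])      ≈⟨ run-singleton m eProd (λ p k → eProd p * E k) eProd-snoc ⟩
    sumTo R (suc m) (λ b → subsetSum m b * run (m ∸ b) (λ p → eProd p * E (suc b)) [])
      ≈⟨ sumTo-cong (suc m) (λ b _ → *-congˡ (lowerPart (m ∸ b) (E (suc b)))) ⟩
    sumTo R (suc m) (λ b → subsetSum m b * (LK R xs q (m ∸ b) * E (suc b))) ∎
    where
    lowerPart : ∀ N e → run N (λ p → eProd p * e) [] ≈ LK R xs q N * e
    lowerPart N e = begin
      run N (λ p → eProd p * e) [] ≈⟨ run-cong N (λ p → *-comm _ _) [] ⟩
      run N (λ p → e * eProd p) [] ≈⟨ run-scale N e eProd [] ⟩
      e * run N eProd []           ≈⟨ *-congˡ (LK-run N) ⟨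
      e * LK R xs q N              ≈⟨ *-comm _ _ ⟩
      LK R xs q N * e              ∎

lemma4p4 : {c ℓ : Level} (R : CommutativeRing c ℓ) →
    let open CommutativeRing R in
    (xs : List Carrier) (q : Carrier) →
      (LK R xs q 0 ≈ 1#) ×
      ((n : ℕ) → 1 ≤ n → LK R xs q n ≈
        sumTo R n (λ i → (LK R xs q i * esym R (n ∸ i) xs) *
          sumList R (map (subsetWeight R q 1) (subsets (n ∸ 1 ∸ i) (n ∸ 1)))))
lemma4p4 R xs q = LK-zero , recursion
  where
  open CommutativeRing R
  open Relation.Binary.Reasoning.Setoid setoid
  open Sums R
  open Transfer R q using (subsetSum)
  open Recursion R xs q

  term : ℕ → ℕ → Carrier
  term m i = (LK R xs q i * E (suc m ∸ i)) * subsetSum m (m ∸ i)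

  reindex : ∀ m b → b ≤ m → subsetSum m b * (LK R xs q (m ∸ b) * E (suc b)) ≈ term m (m ∸ b)
  reindex m b b≤m = trans (*-comm _ _)
    (reflexive (≡.cong₂ (λ k j → (LK R xs q (m ∸ b) * E k) * subsetSum m j) (≡.sym 1+m∸i≡1+b) (≡.sym m∸i≡b)))
    where
    m∸i≡b : m ∸ (m ∸ b) ≡ b
    m∸i≡b = ℕₚ.m∸[m∸n]≡n b≤m
    1+m∸i≡1+b : suc m ∸ (m ∸ b) ≡ suc b
    1+m∸i≡1+b = ≡.trans (ℕₚ.+-∸-assoc 1 (ℕₚ.m∸n≤m m b)) (≡.cong suc m∸i≡b)

  recursion : (n : ℕ) → 1 ≤ n → LK R xs q n ≈ sumTo R n (λ i → (LK R xs q i * E (n ∸ i)) * subsetSum (n ∸ 1) (n ∸ 1 ∸ i))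
  recursion (suc m) _ = begin
    LK R xs q (suc m)                        ≈⟨ LK-suc m ⟩
    sumTo R (suc m) (λ b → subsetSum m b * (LK R xs q (m ∸ b) * E (suc b)))
      ≈⟨ sumTo-cong (suc m) (λ b b<1+m → reindex m b (ℕₚ.≤-pred b<1+m)) ⟩
    sumTo R (suc m) (λ b → term m (m ∸ b))   ≈⟨ sumTo-reverse m (term m) ⟨
    sumTo R (suc m) (term m)                 ∎
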